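{- Let $G$ be a connected graph and $H$ any graph. Then $\xi(G\odot H)=\mathrm{n}(G)$ if and only if either $\beta(\widehat{G})=0$, or ($\mathrm{n}(H)=1$ and $\beta^*(G)=0$).
   Context: All graphs are finite, simple and undirected; $\mathrm{n}(H)$ denotes the order of $H$. For a connected graph $\Gamma$, a set $S\subseteq V(\Gamma)$ is a distance-equalizer set if for every two distinct $u,v\in V(\Gamma)\setminus S$ there is $w\in S$ with $d_\Gamma(w,u)=d_\Gamma(w,v)$; $\xi(\Gamma)$ is the minimum cardinality of a distance-equalizer set of $\Gamma$. For $V(G)=\{v_1,\dots,v_n\}$, the corona product $G\odot H$ is obtained from $G$ and $n$ pairwise disjoint copies $H_1,\dots,H_n$ of $H$ by joining $v_i$ to every vertex of $H_i$. The empty bisector graph $\widehat{G}$ has vertex set $V(G)$, with distinct $u,v$ adjacent iff there is no $w\in V(G)$ with $d_G(w,u)=d_G(w,v)$. $\beta$ denotes the vertex cover number. A pair $(X,Y)$ of subsets of $V(G)$ with $X\cup Y=V(G)$ is a forward-equalized pair of $G$ if for every $(u,v)\in (X\setminus Y)\times(Y\setminus X)$ there exists $w\in V(G)$ with $d_G(w,u)=d_G(w,v)+1$. $\beta^*(G)=\min\{|X\cap Y| : X,Y \text{ vertex covers of } \widehat{G},\ (X,Y) \text{ a forward-equalized pair of } G\}$. -}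

module Defs where

open import Data.Nat using (ℕ; zero; suc; _+_; _*_; _≤_; _<_)
open import Data.Bool using (Bool; true; false; _∧_)
open import Data.Bool.Properties using (∧-zeroʳ)
open import Data.Fin using (Fin; splitAt; remQuot; _≟_)
open import Data.Fin.Subset using (Subset; _∈_; _∉_; _∩_; ∣_∣)
open import Data.Sum using (_⊎_; inj₁; inj₂)
open import Data.Product using (_×_; _,_; Σ; ∃; ∃-syntax)
open import Relation.Nullary using (¬_; yes; no)
open import Relation.Binary.PropositionalEquality using (_≡_; _≢_; refl)

record Graph : Set where
  field
    order : ℕ
    adj   : Fin order → Fin order → Bool
    sym   : ∀ u v → adj u v ≡ adj v u
    irrefl : ∀ u → adj u u ≡ false

open Graph public

Vertex : Graph → Set
Vertex G = Fin (order G)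

Edge : (G : Graph) → Vertex G → Vertex G → Set
Edge G u v = adj G u v ≡ true

data Walk (G : Graph) : Vertex G → Vertex G → ℕ → Set where
  here : ∀ {u} → Walk G u u zero
  step : ∀ {u v w k} → Edge G u v → Walk G v w k → Walk G u w (suc k)

Connected : Graph → Set
Connected G = (1 ≤ order G) × (∀ u v → ∃[ k ] Walk G u v k)

Dist : (G : Graph) → Vertex G → Vertex G → ℕ → Set
Dist G u v k = Walk G u v k × (∀ m → m < k → ¬ Walk G u v m)

EqDist : (G : Graph) → Vertex G → Vertex G → Vertex G → Set
EqDist G w u v = ∃[ k ] (Dist G w u k × Dist G w v k)

IsMinimum : {A : Set} → (A → Set) → (A → ℕ) → ℕ → Set
IsMinimum {A} P f k = (Σ A λ a → P a × f a ≡ k) × (∀ a → P a → k ≤ f a)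

IsDistanceEqualizer : (Γ : Graph) → Subset (order Γ) → Set
IsDistanceEqualizer Γ S =
  ∀ u v → u ≢ v → u ∉ S → v ∉ S → ∃[ w ] (w ∈ S × EqDist Γ w u v)

ξ≡ : Graph → ℕ → Set
ξ≡ Γ k = IsMinimum (IsDistanceEqualizer Γ) ∣_∣ k

-- corona product G ⊙ H on vertex set Fin (n(G) + n(G) * n(H)):
-- the first n(G) vertices are those of G; vertex (i , a) encodes
-- vertex a of the copy H_i.
CoronaVertex : ℕ → ℕ → Set
CoronaVertex n m = Fin n ⊎ (Fin n × Fin m)

decode : ∀ n m → Fin (n + n * m) → CoronaVertex n m
decode n m x with splitAt n x
... | inj₁ i = inj₁ i
... | inj₂ p = inj₂ (remQuot m p)

module _ (G H : Graph) where
  private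
    n = order G
    m = order H

  coronaAdj : CoronaVertex n m → CoronaVertex n m → Bool
  coronaAdj (inj₁ i) (inj₁ j) = adj G i j
  coronaAdj (inj₁ i) (inj₂ (j , a)) with i ≟ j
  ... | yes _ = true
  ... | no _ = false
  coronaAdj (inj₂ (j , a)) (inj₁ i) with i ≟ j
  ... | yes _ = true
  ... | no _ = false
  coronaAdj (inj₂ (i , a)) (inj₂ (j , b)) with i ≟ j
  ... | yes _ = adj H a b
  ... | no _ = false

  coronaAdj-sym : ∀ x y → coronaAdj x y ≡ coronaAdj y x
  coronaAdj-sym (inj₁ i) (inj₁ j) = sym G i j
  coronaAdj-sym (inj₁ i) (inj₂ (j , a)) with i ≟ j
  ... | yes _ = refl
  ... | no _ = refl
  coronaAdj-sym (inj₂ (j , a)) (inj₁ i) with i ≟ j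
  ... | yes _ = refl
  ... | no _ = refl
  coronaAdj-sym (inj₂ (i , a)) (inj₂ (j , b)) with i ≟ j | j ≟ i
  ... | yes _ | yes _ = sym H a b
  ... | yes p | no q = Data.Empty.⊥-elim (q (Relation.Binary.PropositionalEquality.sym p))
    where import Data.Empty
  ... | no p | yes q = Data.Empty.⊥-elim (p (Relation.Binary.PropositionalEquality.sym q))
    where import Data.Empty
  ... | no _ | no _ = refl

  coronaAdj-irrefl : ∀ x → coronaAdj x x ≡ false
  coronaAdj-irrefl (inj₁ i) = irrefl G i
  coronaAdj-irrefl (inj₂ (i , a)) with i ≟ i
  ... | yes _ = irrefl H a
  ... | no _ = refl

  corona : Graph
  corona = record
    { order = n + n * m
    ; adj = λ x y → coronaAdj (decode n m x) (decode n m y)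
    ; sym = λ x y → coronaAdj-sym (decode n m x) (decode n m y)
    ; irrefl = λ x → coronaAdj-irrefl (decode n m x)
    }

_⊙_ : Graph → Graph → Graph
G ⊙ H = corona G H

BisectorEdge : (G : Graph) → Vertex G → Vertex G → Set
BisectorEdge G u v = u ≢ v × ¬ (∃[ w ] EqDist G w u v)

IsVertexCoverBisector : (G : Graph) → Subset (order G) → Set
IsVertexCoverBisector G S = ∀ u v → BisectorEdge G u v → u ∈ S ⊎ v ∈ S

βBisector≡ : Graph → ℕ → Set
βBisector≡ G k = IsMinimum (IsVertexCoverBisector G) ∣_∣ k

IsForwardEqualizedPair : (G : Graph) → Subset (order G) → Subset (order G) → Set
IsForwardEqualizedPair G X Y =
  (∀ v → v ∈ X ⊎ v ∈ Y) ×
  (∀ u v → u ∈ X → u ∉ Y → v ∈ Y → v ∉ X →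
     ∃[ w ] ∃[ k ] (Dist G w u (suc k) × Dist G w v k))

β*≡ : Graph → ℕ → Set
β*≡ G k =
  IsMinimum {Subset (order G) × Subset (order G)}
    (λ { (X , Y) → IsVertexCoverBisector G X × IsVertexCoverBisector G Y
                    × IsForwardEqualizedPair G X Y })
    (λ { (X , Y) → ∣ X ∩ Y ∣ })
    k

{-# OPTIONS --safe #-}
-- Write vG k for the vertices of G inside G ⊙ H and vH k a for those of the copy H_k.  A vertex
-- outside H_k is seen from vG k at distance baseDist k x = d_G(k, block x) + [x ∈ H], and from any
-- vertex of H_k at distance one more.  So, away from its own copy, a vertex equalizes two others
-- exactly when the G-vertex it hangs from does.  Nothing outside block k = {vG k} ∪ H_k equalizes
-- vG k with a vertex of H_k, so an equalizer meets every block: ξ(G ⊙ H) ≥ n(G), and equality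
-- means exactly one vertex per block.  If n(H) ≥ 2 each copy then keeps a free vertex, and
-- equalizing free vertices of different copies equalizes every pair of G-vertices, so Ĝ has no
-- edges.  If n(H) = 1 the blocks met in H resp. in G form a disjoint forward-equalized pair (X , Y)
-- of vertex covers of Ĝ.  Conversely such a pair, or (∅ , V(G)) when Ĝ has no edges, lifts to the
-- equalizer {vG i | i ∈ Y} ∪ ⋃_{i ∈ X} H_i of size n(G).
module Submission where

open import Defs hiding (sym)
open import Data.Bool using (Bool; true)
import Data.Bool.Properties as Bool
open import Data.Empty using (⊥-elim)
open import Data.Fin using (Fin; zero; suc; _≟_; _↑ˡ_; _↑ʳ_; combine; remQuot; splitAt; join; fromℕ<)
open import Data.Fin.Properties
  using (any?; 0≢1+n; ↑ˡ-injective; splitAt-↑ˡ; splitAt-↑ʳ; remQuot-combine; combine-remQuot; join-splitAt)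
import Data.Fin.Properties as Fin
open import Data.Fin.Subset using (Subset; inside; outside; _∈_; _∉_; _∩_; _-_; ∣_∣; ⊤; ⊥; Empty)
open import Data.Fin.Subset.Properties
  using (_∈?_; ∈⊤; ∣⊤∣≡n; ∣⊥∣≡0; Empty-unique; x∈p∩q⁺; x∈p∩q⁻; x∈p∧x≢y⇒x∈p-y; x∈p⇒∣p-x∣<∣p∣)
open import Data.Nat using (ℕ; zero; suc; _+_; _*_; _≤_; _<_; z≤n; s≤s)
import Data.Nat.Properties as ℕ
open import Data.Product using (_×_; _,_; proj₁; proj₂; ∃-syntax; Σ-syntax; map₂; swap; uncurry)
open import Data.Sum using (_⊎_; inj₁; inj₂; [_,_]′)
open import Data.Vec using ([]; _∷_; here; there; lookup; tabulate)
open import Data.Vec.Properties using (lookup∘tabulate; []=⇒lookup; lookup⇒[]=)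
open import Function using (_∘_; id)
open import Function.Bundles using (_⇔_; mk⇔; Equivalence)
import Function.Properties.Equivalence as ⇔
open import Relation.Binary.PropositionalEquality using (_≡_; _≢_; refl; sym; trans; cong; subst; subst₂)
open import Relation.Nullary using (¬_; Dec; yes; no)
open import Relation.Nullary.Decidable using (_×-dec_)

open Equivalence using (to; from)

InjectiveOn : ∀ {k l} → (Fin k → Fin l) → Subset k → Set
InjectiveOn f p = ∀ {x y} → x ∈ p → y ∈ p → f x ≡ f y → x ≡ y

Onto : ∀ {k l} → (Fin l → Fin k) → Subset l → Set
Onto {k} f p = ∀ (i : Fin k) → ∃[ x ] (x ∈ p × f x ≡ i)

injectiveOn⇒∣p∣≤∣q∣ : ∀ {k l} {p : Subset k} {q : Subset l} (f : Fin k → Fin l) →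
  (∀ {x} → x ∈ p → f x ∈ q) → InjectiveOn f p → ∣ p ∣ ≤ ∣ q ∣
injectiveOn⇒∣p∣≤∣q∣ {p = []} f _ _ = z≤n
injectiveOn⇒∣p∣≤∣q∣ {p = outside ∷ p} f into inj =
  injectiveOn⇒∣p∣≤∣q∣ (f ∘ suc) (into ∘ there) (λ x y e → Fin.suc-injective (inj (there x) (there y) e))
injectiveOn⇒∣p∣≤∣q∣ {p = inside ∷ p} {q} f into inj =
  ℕ.≤-<-trans
    (injectiveOn⇒∣p∣≤∣q∣ {q = q - f zero} (f ∘ suc)
      (λ x∈p → x∈p∧x≢y⇒x∈p-y (into (there x∈p)) (λ e → 0≢1+n (inj here (there x∈p) (sym e))))
      (λ x y e → Fin.suc-injective (inj (there x) (there y) e)))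
    (x∈p⇒∣p-x∣<∣p∣ (into here))

injectiveOn⇒∣p∣≤k : ∀ {k l} {p : Subset l} (f : Fin l → Fin k) → InjectiveOn f p → ∣ p ∣ ≤ k
injectiveOn⇒∣p∣≤k {k} f inj = subst (_ ≤_) (∣⊤∣≡n k) (injectiveOn⇒∣p∣≤∣q∣ f (λ _ → ∈⊤) inj)

onto⇒≤∣p∣ : ∀ {k l} {p : Subset l} (f : Fin l → Fin k) → Onto f p → k ≤ ∣ p ∣
onto⇒≤∣p∣ {k} {p = p} f onto = subst (_≤ ∣ p ∣) (∣⊤∣≡n k)
  (injectiveOn⇒∣p∣≤∣q∣ {p = ⊤} (proj₁ ∘ onto) (λ {i} _ → proj₁ (proj₂ (onto i)))
    (λ {i} {j} _ _ e → trans (sym (proj₂ (proj₂ (onto i)))) (trans (cong f e) (proj₂ (proj₂ (onto j))))))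

-- Otherwise f would still be onto after removing one of two points with the same image.
onto⇒injectiveOn : ∀ {k l} {p : Subset l} (f : Fin l → Fin k) → Onto f p → ∣ p ∣ ≤ k → InjectiveOn f p
onto⇒injectiveOn {k} {p = p} f onto ∣p∣≤k {x} {y} x∈p y∈p fx≡fy with x ≟ y
... | yes x≡y = x≡y
... | no x≢y = ⊥-elim (ℕ.<-irrefl refl (ℕ.<-≤-trans (x∈p⇒∣p-x∣<∣p∣ y∈p)
                  (ℕ.≤-trans ∣p∣≤k (onto⇒≤∣p∣ f onto-without-y))))
  where
  onto-without-y : Onto f (p - y)
  onto-without-y i with onto i
  ... | z , z∈p , fz≡i with z ≟ y
  ...   | yes refl = x , x∈p∧x≢y⇒x∈p-y x∈p x≢y , trans fx≡fy fz≡i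
  ...   | no z≢y = z , x∈p∧x≢y⇒x∈p-y z∈p z≢y , fz≡i

Empty⇒∣p∣≡0 : ∀ {k} {p : Subset k} → Empty p → ∣ p ∣ ≡ 0
Empty⇒∣p∣≡0 {k} e = trans (cong ∣_∣ (Empty-unique e)) (∣⊥∣≡0 k)

∣p∣≡0⇒Empty : ∀ {k} {p : Subset k} → ∣ p ∣ ≡ 0 → Empty p
∣p∣≡0⇒Empty {p = p} ∣p∣≡0 (x , x∈p) = ℕ.n≮0 (subst (∣ p - x ∣ <_) ∣p∣≡0 (x∈p⇒∣p-x∣<∣p∣ x∈p))

∈-tabulate⇔ : ∀ {k l} {f : Fin k → Bool} {x} {p : Subset l} {i} → f x ≡ lookup p i → x ∈ tabulate f ⇔ i ∈ p
∈-tabulate⇔ {f = f} {x} {p} {i} fx≡pi = mk⇔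
  (λ x∈ → lookup⇒[]= i p (trans (sym fx≡pi) (trans (sym (lookup∘tabulate f x)) ([]=⇒lookup x∈))))
  (λ i∈p → lookup⇒[]= x (tabulate f) (trans (lookup∘tabulate f x) (trans fx≡pi ([]=⇒lookup i∈p))))

preimage : ∀ {k l} → (Fin k → Fin l) → Subset l → Subset k
preimage f q = tabulate (lookup q ∘ f)

∈-preimage : ∀ {k l} {f : Fin k → Fin l} {q : Subset l} {x} → x ∈ preimage f q ⇔ f x ∈ q
∈-preimage = ∈-tabulate⇔ refl

Fin1-unique : ∀ {k} → k ≡ 1 → (a b : Fin k) → a ≡ b
Fin1-unique refl zero zero = refl

one-or-two : ∀ {k} → 1 ≤ k → k ≡ 1 ⊎ Σ[ a ∈ Fin k ] Σ[ b ∈ Fin k ] a ≢ b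
one-or-two {suc zero} _ = inj₁ refl
one-or-two {suc (suc k)} _ = inj₂ (zero , suc zero , λ ())

least : {P : ℕ → Set} → (∀ k → Dec (P k)) → ∀ {k} → P k → ∃[ d ] (P d × (∀ j → j < d → ¬ P j))
least P? {k} p with P? 0
... | yes p₀ = 0 , p₀ , λ _ ()
least P? {zero} p | no ¬p₀ = ⊥-elim (¬p₀ p)
least P? {suc k} p | no ¬p₀ with least (P? ∘ suc) p
... | d , pd , below = suc d , pd , λ { zero _ → ¬p₀ ; (suc j) (s≤s j<d) → below j j<d }

module _ {Γ : Graph} where

  Walk-snoc : ∀ {u v w k} → Walk Γ u v k → Edge Γ v w → Walk Γ u w (suc k)
  Walk-snoc here e = step e here
  Walk-snoc (step e′ p) e = step e′ (Walk-snoc p e)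

  walk? : ∀ k u v → Dec (Walk Γ u v k)
  walk? zero u v with u ≟ v
  ... | yes refl = yes here
  ... | no u≢v = no λ { here → u≢v refl }
  walk? (suc k) u v with any? (λ w → (adj Γ u w Bool.≟ true) ×-dec walk? k w v)
  ... | yes (w , e , p) = yes (step e p)
  ... | no none = no λ { (step {v = w} e p) → none (w , e , p) }

  Dist⇒≤ : ∀ {x y d k} → Dist Γ x y d → Walk Γ x y k → d ≤ k
  Dist⇒≤ (_ , shortest) p = ℕ.≮⇒≥ (λ k<d → shortest _ k<d p)

  Dist-unique : ∀ {x y d e} → Dist Γ x y d → Dist Γ x y e → d ≡ e
  Dist-unique D E = ℕ.≤-antisym (Dist⇒≤ D (proj₁ E)) (Dist⇒≤ E (proj₁ D))

  EqDist⇔≡ : ∀ {w x y d e} → Dist Γ w x d → Dist Γ w y e → EqDist Γ w x y ⇔ d ≡ e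
  EqDist⇔≡ D E = mk⇔
    (λ (_ , D′ , E′) → trans (Dist-unique D D′) (Dist-unique E′ E))
    (λ { refl → _ , D , E })

  Lipschitz : (Vertex Γ → ℕ) → Set
  Lipschitz f = ∀ {u v} → Edge Γ u v → f v ≤ suc (f u)

  Lipschitz⇒≤+length : ∀ {f} → Lipschitz f → ∀ {u v k} → Walk Γ u v k → f v ≤ f u + k
  Lipschitz⇒≤+length {f} lip {u} here = ℕ.m≤m+n (f u) 0
  Lipschitz⇒≤+length {f} lip {u} (step {v = w} {k = k} e p) = begin
    f _           ≤⟨ Lipschitz⇒≤+length lip p ⟩
    f w + k       ≤⟨ ℕ.+-monoˡ-≤ k (lip e) ⟩
    suc (f u) + k ≡⟨ sym (ℕ.+-suc (f u) k) ⟩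
    f u + suc k   ∎
    where open ℕ.≤-Reasoning

  Dist-by-potential : ∀ (f : Vertex Γ → ℕ) → Lipschitz f → ∀ {x y d} →
    f x ≡ 0 → Walk Γ x y d → d ≤ f y → Dist Γ x y d
  Dist-by-potential f lip fx≡0 p d≤fy =
    p , λ k k<d q → ℕ.<⇒≱ k<d (ℕ.≤-trans d≤fy (subst (λ z → f _ ≤ z + k) fx≡0 (Lipschitz⇒≤+length lip q)))

  cover-of-equalized : ∀ {X : Subset (order Γ)} →
    (∀ {u v} → u ∉ X → v ∉ X → u ≢ v → ∃[ w ] EqDist Γ w u v) → IsVertexCoverBisector Γ X
  cover-of-equalized {X} equalized u v (u≢v , none) with u ∈? X | v ∈? X
  ... | yes u∈X | _ = inj₁ u∈X
  ... | no _ | yes v∈X = inj₂ v∈X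
  ... | no u∉X | no v∉X = ⊥-elim (none (equalized u∉X v∉X u≢v))

module Distance (G : Graph) (conn : Connected G) where

  private
    shortest : ∀ u v → ∃[ d ] Dist G u v d
    shortest u v = least (λ k → walk? k u v) (proj₂ (proj₂ conn u v))

  -- Opaque, so that unification never unfolds the search for a shortest walk.
  opaque
    dist : Vertex G → Vertex G → ℕ
    dist u v = proj₁ (shortest u v)

    dist-Dist : ∀ {u v} → Dist G u v (dist u v)
    dist-Dist {u} {v} = proj₂ (shortest u v)

  dist-self : ∀ {u} → dist u u ≡ 0
  dist-self = ℕ.n≤0⇒n≡0 (Dist⇒≤ dist-Dist here)

  dist≡0⇒≡ : ∀ {u v} → dist u v ≡ 0 → u ≡ v
  dist≡0⇒≡ {u} {v} d≡0 with subst (Walk G u v) d≡0 (proj₁ dist-Dist)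
  ... | here = refl

  dist-edge : ∀ {u v w} → Edge G v w → dist u w ≤ suc (dist u v)
  dist-edge e = Dist⇒≤ dist-Dist (Walk-snoc (proj₁ dist-Dist) e)

  EqDist⇔dist : ∀ {w u v} → EqDist G w u v ⇔ dist w u ≡ dist w v
  EqDist⇔dist = EqDist⇔≡ dist-Dist dist-Dist

  forward⇔dist : ∀ {w u v} → (∃[ k ] (Dist G w u (suc k) × Dist G w v k)) ⇔ dist w u ≡ suc (dist w v)
  forward⇔dist = mk⇔
    (λ (_ , Du , Dv) → trans (Dist-unique dist-Dist Du) (cong suc (Dist-unique Dv dist-Dist)))
    (λ e → _ , subst (Dist G _ _) e dist-Dist , dist-Dist)

  equalizer-of-cover : ∀ {X} → IsVertexCoverBisector G X →
    ∀ {u v} → u ∉ X → v ∉ X → u ≢ v → ∃[ w ] EqDist G w u v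
  equalizer-of-cover cover {u} {v} u∉X v∉X u≢v
    with any? (λ w → dist w u ℕ.≟ dist w v)
  ... | yes (w , e) = w , from EqDist⇔dist e
  ... | no none with cover u v (u≢v , λ (w , eq) → none (w , to EqDist⇔dist eq))
  ...   | inj₁ u∈X = ⊥-elim (u∉X u∈X)
  ...   | inj₂ v∈X = ⊥-elim (v∉X v∈X)

module Corona (G H : Graph) (conn : Connected G) (1≤m : 1 ≤ order H) where
  open Distance G conn

  n m : ℕ
  n = order G
  m = order H

  C : Graph
  C = G ⊙ H

  a₀ : Fin m
  a₀ = fromℕ< 1≤m

  vG : Fin n → Vertex C
  vG i = i ↑ˡ (n * m)

  vH : Fin n → Fin m → Vertex C
  vH i a = n ↑ʳ combine i a

  decode-vG : ∀ {i} → decode n m (vG i) ≡ inj₁ i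
  decode-vG {i} rewrite splitAt-↑ˡ n i (n * m) = refl

  decode-vH : ∀ {i a} → decode n m (vH i a) ≡ inj₂ (i , a)
  decode-vH {i} {a} rewrite splitAt-↑ʳ n (n * m) (combine i a) | remQuot-combine {n} {m} i a = refl

  vG≢vH : ∀ {i j b} → vG i ≢ vH j b
  vG≢vH e with trans (sym decode-vG) (trans (cong (decode n m) e) decode-vH)
  ... | ()

  vH-injective : ∀ {i j a b} → vH i a ≡ vH j b → i ≡ j × a ≡ b
  vH-injective e with trans (sym decode-vH) (trans (cong (decode n m) e) decode-vH)
  ... | refl = refl , refl

  data Position : Vertex C → Set where
    gvertex : ∀ i → Position (vG i)
    hvertex : ∀ i a → Position (vH i a)

  position : ∀ x → Position x
  position x = subst Position (join-splitAt n (n * m) x) (position′ (splitAt n x))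
    where
    position′ : ∀ s → Position (join n (n * m) s)
    position′ (inj₁ i) = gvertex i
    position′ (inj₂ p) = subst (Position ∘ (n ↑ʳ_)) (combine-remQuot {n} m p)
                           (hvertex (proj₁ (remQuot {n} m p)) (proj₂ (remQuot {n} m p)))

  block : Vertex C → Fin n
  block = [ id , proj₁ ]′ ∘ decode n m

  block-vG : ∀ {i} → block (vG i) ≡ i
  block-vG = cong [ id , proj₁ ]′ decode-vG

  block-vH : ∀ {i a} → block (vH i a) ≡ i
  block-vH = cong [ id , proj₁ ]′ decode-vH

  -- `fibre` forgets the edge of H: no distance bound below depends on it.
  data CoronaEdge : CoronaVertex n m → CoronaVertex n m → Set where
    base   : ∀ {i j} → Edge G i j → CoronaEdge (inj₁ i) (inj₁ j)
    spoke  : ∀ {i a} → CoronaEdge (inj₁ i) (inj₂ (i , a))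
    spoke⁻ : ∀ {i a} → CoronaEdge (inj₂ (i , a)) (inj₁ i)
    fibre  : ∀ {i a b} → CoronaEdge (inj₂ (i , a)) (inj₂ (i , b))

  coronaEdge : ∀ {p q} → coronaAdj G H p q ≡ true → CoronaEdge p q
  coronaEdge {inj₁ i} {inj₁ j} e = base e
  coronaEdge {inj₁ i} {inj₂ (j , a)} e with i ≟ j
  ... | yes refl = spoke
  coronaEdge {inj₁ i} {inj₂ (j , a)} () | no _
  coronaEdge {inj₂ (j , a)} {inj₁ i} e with i ≟ j
  ... | yes refl = spoke⁻
  coronaEdge {inj₂ (j , a)} {inj₁ i} () | no _
  coronaEdge {inj₂ (i , a)} {inj₂ (j , b)} e with i ≟ j
  ... | yes refl = fibre
  coronaEdge {inj₂ (i , a)} {inj₂ (j , b)} () | no _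

  lipschitz-decode : ∀ {f : CoronaVertex n m → ℕ} →
    (∀ {p q} → CoronaEdge p q → f q ≤ suc (f p)) → Lipschitz {C} (f ∘ decode n m)
  lipschitz-decode lip e = lip (coronaEdge e)

  edge-decode : ∀ {x y p q} → decode n m x ≡ p → decode n m y ≡ q → coronaAdj G H p q ≡ true → Edge C x y
  edge-decode refl refl e = e

  spoke-adj : ∀ {i a} → coronaAdj G H (inj₁ i) (inj₂ (i , a)) ≡ true
  spoke-adj {i} with i ≟ i
  ... | yes _ = refl
  ... | no i≢i = ⊥-elim (i≢i refl)

  spoke-edge : ∀ {i a} → Edge C (vG i) (vH i a)
  spoke-edge {i} {a} = edge-decode decode-vG decode-vH (spoke-adj {i} {a})

  spoke⁻-edge : ∀ {i a} → Edge C (vH i a) (vG i)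
  spoke⁻-edge {i} {a} = trans (Graph.sym C (vH i a) (vG i)) spoke-edge

  lift-walk : ∀ {i j k} → Walk G i j k → Walk C (vG i) (vG j) k
  lift-walk here = here
  lift-walk (step e p) = step (edge-decode decode-vG decode-vG e) (lift-walk p)

  private
    baseDist′ : Fin n → CoronaVertex n m → ℕ
    baseDist′ k (inj₁ j) = dist k j
    baseDist′ k (inj₂ (j , _)) = suc (dist k j)

    bump : ℕ → ℕ
    bump zero = zero
    bump (suc d) = suc (suc (suc d))

    copyPotential′ : Fin n → CoronaVertex n m → ℕ
    copyPotential′ k (inj₁ j) = suc (dist k j)
    copyPotential′ k (inj₂ (j , _)) = bump (dist k j)

    bump≤2+ : ∀ d → bump d ≤ suc (suc d)
    bump≤2+ zero = z≤n
    bump≤2+ (suc d) = ℕ.≤-refl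

    ≤bump : ∀ d → d ≤ bump d
    ≤bump zero = z≤n
    ≤bump (suc d) = s≤s (ℕ.m≤n+m d 2)

    2+≤bump : ∀ {d} → d ≢ 0 → suc (suc d) ≤ bump d
    2+≤bump {zero} d≢0 = ⊥-elim (d≢0 refl)
    2+≤bump {suc d} _ = ℕ.≤-refl

  baseDist : Fin n → Vertex C → ℕ
  baseDist k = baseDist′ k ∘ decode n m

  baseDist-vG : ∀ {k j} → baseDist k (vG j) ≡ dist k j
  baseDist-vG {k} = cong (baseDist′ k) decode-vG

  baseDist-vH : ∀ {k j b} → baseDist k (vH j b) ≡ suc (dist k j)
  baseDist-vH {k} = cong (baseDist′ k) decode-vH

  -- 1 + baseDist k off the copy H_k and 0 on it; being 1-Lipschitz, it bounds the distances from H_k below.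
  copyPotential : Fin n → Vertex C → ℕ
  copyPotential k = copyPotential′ k ∘ decode n m

  baseDist-lipschitz : ∀ {k} → Lipschitz {C} (baseDist k)
  baseDist-lipschitz {k} = lipschitz-decode {baseDist′ k} λ where
    (base e) → dist-edge e
    spoke    → ℕ.≤-refl
    spoke⁻   → ℕ.m≤n⇒m≤1+n (ℕ.n≤1+n _)
    fibre    → ℕ.n≤1+n _

  copyPotential-lipschitz : ∀ {k} → Lipschitz {C} (copyPotential k)
  copyPotential-lipschitz {k} = lipschitz-decode {copyPotential′ k} λ where
    (base e) → s≤s (dist-edge e)
    spoke    → bump≤2+ _
    spoke⁻   → s≤s (≤bump _)
    fibre    → ℕ.n≤1+n _

  walk-from-vG : ∀ k x → Walk C (vG k) x (baseDist k x)
  walk-from-vG k x with position x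
  ... | gvertex j = subst (Walk C (vG k) (vG j)) (sym baseDist-vG) (lift-walk (proj₁ dist-Dist))
  ... | hvertex j b = subst (Walk C (vG k) (vH j b)) (sym baseDist-vH)
                        (Walk-snoc (lift-walk (proj₁ dist-Dist)) spoke-edge)

  Dist-from-vG : ∀ k x → Dist C (vG k) x (baseDist k x)
  Dist-from-vG k x = Dist-by-potential (baseDist k) baseDist-lipschitz
    (trans baseDist-vG dist-self) (walk-from-vG k x) ℕ.≤-refl

  Far : Vertex C → Vertex C → Set
  Far w x = ∀ {k a b} → w ≡ vH k a → x ≢ vH k b

  Far-from-vG : ∀ {k x} → Far (vG k) x
  Far-from-vG e _ = vG≢vH e

  Far-to-vG : ∀ {w j} → Far w (vG j)
  Far-to-vG _ e = vG≢vH e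

  Far-across : ∀ {k j a b} → k ≢ j → Far (vH k a) (vH j b)
  Far-across k≢j e e′ = k≢j (trans (proj₁ (vH-injective e)) (sym (proj₁ (vH-injective e′))))

  copyPotential-far : ∀ {k c x} → Far (vH k c) x → suc (baseDist k x) ≤ copyPotential k x
  copyPotential-far {k} {x = x} far with position x
  ... | gvertex j = ℕ.≤-reflexive
    (trans (cong (suc ∘ baseDist′ k) decode-vG) (sym (cong (copyPotential′ k) decode-vG)))
  ... | hvertex j b = subst₂ _≤_ (sym (cong suc baseDist-vH)) (sym (cong (copyPotential′ k) decode-vH))
                        (2+≤bump (k≢j ∘ dist≡0⇒≡))
    where
    k≢j : k ≢ j
    k≢j refl = far refl refl

  Dist-from-vH : ∀ {k c x} → Far (vH k c) x → Dist C (vH k c) x (suc (baseDist k x))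
  Dist-from-vH {k} {x = x} far = Dist-by-potential (copyPotential k) copyPotential-lipschitz
    (trans (cong (copyPotential′ k) decode-vH) (cong bump dist-self))
    (step spoke⁻-edge (walk-from-vG k x)) (copyPotential-far far)

  EqDist-far : ∀ {w x y} → Far w x → Far w y →
    EqDist C w x y ⇔ (baseDist (block w) x ≡ baseDist (block w) y)
  EqDist-far {w} {x} {y} fx fy with position w
  ... | gvertex k rewrite block-vG {k} = EqDist⇔≡ (Dist-from-vG k x) (Dist-from-vG k y)
  ... | hvertex k c rewrite block-vH {k} {c} =
    ⇔.trans (EqDist⇔≡ (Dist-from-vH fx) (Dist-from-vH fy)) (mk⇔ ℕ.suc-injective (cong suc))

  baseDist-vG≡⇔ : ∀ {k i j} → baseDist k (vG i) ≡ baseDist k (vG j) ⇔ EqDist G k i j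
  baseDist-vG≡⇔ {k} {i} {j} rewrite baseDist-vG {k} {i} | baseDist-vG {k} {j} = ⇔.sym EqDist⇔dist

  baseDist-vH≡⇔ : ∀ {k i j a b} → baseDist k (vH i a) ≡ baseDist k (vH j b) ⇔ EqDist G k i j
  baseDist-vH≡⇔ {k} {i} {j} {a} {b} rewrite baseDist-vH {k} {i} {a} | baseDist-vH {k} {j} {b} =
    ⇔.trans (mk⇔ ℕ.suc-injective (cong suc)) (⇔.sym EqDist⇔dist)

  baseDist-vG-vH≡⇔ : ∀ {k i j b} →
    baseDist k (vG i) ≡ baseDist k (vH j b) ⇔ (∃[ d ] (Dist G k i (suc d) × Dist G k j d))
  baseDist-vG-vH≡⇔ {k} {i} {j} {b} rewrite baseDist-vG {k} {i} | baseDist-vH {k} {j} {b} =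
    ⇔.sym forward⇔dist

  spoke-unbalanced : ∀ {k i a} → baseDist k (vG i) ≢ baseDist k (vH i a)
  spoke-unbalanced e = ℕ.1+n≢n (sym (trans (sym baseDist-vG) (trans e baseDist-vH)))

  equalizer-of-spoke : ∀ {w i a} → EqDist C w (vG i) (vH i a) → block w ≡ i
  equalizer-of-spoke {w} {i} eq with position w
  ... | gvertex k = ⊥-elim (spoke-unbalanced (to (EqDist-far Far-to-vG Far-from-vG) eq))
  ... | hvertex k c with k ≟ i
  ...   | yes refl = block-vH
  ...   | no k≢i = ⊥-elim (spoke-unbalanced (to (EqDist-far Far-to-vG (Far-across k≢i)) eq))

  -- Inside its own copy a vertex of H sees everything within distance 2, the other copies at distance at least 3.
  copy-unbalanced : ∀ {i j a b c} → i ≢ j → ¬ EqDist C (vH i c) (vH i a) (vH j b)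
  copy-unbalanced {i} {j} {b = b} i≢j (d , Da , Db) =
    i≢j (dist≡0⇒≡ (ℕ.n≤0⇒n≡0 (ℕ.≤-pred (ℕ.≤-pred (begin
      suc (suc (dist i j))      ≡⟨ cong suc baseDist-vH ⟨
      suc (baseDist i (vH j b)) ≡⟨ Dist-unique (Dist-from-vH (Far-across i≢j)) Db ⟩
      d                         ≤⟨ Dist⇒≤ Da (step spoke⁻-edge (step spoke-edge here)) ⟩
      2                         ∎)))))
    where open ℕ.≤-Reasoning

  equalizer-of-copies : ∀ {w i j a b} → i ≢ j → EqDist C w (vH i a) (vH j b) → ∃[ k ] EqDist G k i j
  equalizer-of-copies {w} {i} {j} i≢j eq with position w
  ... | gvertex k = _ , to baseDist-vH≡⇔ (to (EqDist-far Far-from-vG Far-from-vG) eq)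
  ... | hvertex k c with k ≟ i | k ≟ j
  ...   | yes refl | _ = ⊥-elim (copy-unbalanced i≢j eq)
  ...   | no _ | yes refl = ⊥-elim (copy-unbalanced (i≢j ∘ sym) (map₂ swap eq))
  ...   | no k≢i | no k≢j = _ , to baseDist-vH≡⇔ (to (EqDist-far (Far-across k≢i) (Far-across k≢j)) eq)

  DE⇒onto : ∀ {S} → IsDistanceEqualizer C S → Onto block S
  DE⇒onto {S} de i with vG i ∈? S | vH i a₀ ∈? S
  ... | yes vGi∈S | _ = vG i , vGi∈S , block-vG
  ... | no _ | yes vHi∈S = vH i a₀ , vHi∈S , block-vH
  ... | no vGi∉S | no vHi∉S with de (vG i) (vH i a₀) vG≢vH vGi∉S vHi∉S
  ...   | w , w∈S , eq = w , w∈S , equalizer-of-spoke eq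

  ξ≡n-intro : ∀ {S} → IsDistanceEqualizer C S → ∣ S ∣ ≤ n → ξ≡ C n
  ξ≡n-intro de ∣S∣≤n = (_ , de , ℕ.≤-antisym ∣S∣≤n (n≤∣DE∣ de)) , λ _ → n≤∣DE∣
    where
    n≤∣DE∣ : ∀ {S} → IsDistanceEqualizer C S → n ≤ ∣ S ∣
    n≤∣DE∣ de = onto⇒≤∣p∣ block (DE⇒onto de)

  CopyClosed : Subset (order C) → Set
  CopyClosed S = ∀ {k a b} → vH k a ∈ S → vH k b ∈ S

  BaseEqualized : Subset (order C) → Set
  BaseEqualized S = ∀ {x y} → x ∉ S → y ∉ S → x ≢ y → ∃[ k ] baseDist k x ≡ baseDist k y

  DE⇔BaseEqualized : ∀ {S} → CopyClosed S → Onto block S → IsDistanceEqualizer C S ⇔ BaseEqualized S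
  DE⇔BaseEqualized {S} closed onto = mk⇔ balanced equalizer
    where
    far : ∀ {w x} → w ∈ S → x ∉ S → Far w x
    far w∈S x∉S refl refl = x∉S (closed w∈S)

    balanced : IsDistanceEqualizer C S → BaseEqualized S
    balanced de {x} {y} x∉S y∉S x≢y with de x y x≢y x∉S y∉S
    ... | w , w∈S , eq = block w , to (EqDist-far (far w∈S x∉S) (far w∈S y∉S)) eq

    equalizer : BaseEqualized S → IsDistanceEqualizer C S
    equalizer bal x y x≢y x∉S y∉S with bal x∉S y∉S x≢y
    ... | k , e with onto k
    ...   | w , w∈S , refl = w , w∈S , from (EqDist-far (far w∈S x∉S) (far w∈S y∉S)) e

  private
    select : Subset n → Subset n → CoronaVertex n m → Bool
    select X Y (inj₁ i) = lookup Y i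
    select X Y (inj₂ (i , _)) = lookup X i

  liftPair : Subset n → Subset n → Subset (order C)
  liftPair X Y = tabulate (select X Y ∘ decode n m)

  vG∈liftPair⇔ : ∀ {X Y i} → vG i ∈ liftPair X Y ⇔ i ∈ Y
  vG∈liftPair⇔ {X} {Y} = ∈-tabulate⇔ (cong (select X Y) decode-vG)

  vH∈liftPair⇔ : ∀ {X Y i a} → vH i a ∈ liftPair X Y ⇔ i ∈ X
  vH∈liftPair⇔ {X} {Y} = ∈-tabulate⇔ (cong (select X Y) decode-vH)

  liftPair-copyClosed : ∀ {X Y} → CopyClosed (liftPair X Y)
  liftPair-copyClosed = from vH∈liftPair⇔ ∘ to vH∈liftPair⇔

  liftPair-onto : ∀ {X Y} → (∀ v → v ∈ X ⊎ v ∈ Y) → Onto block (liftPair X Y)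
  liftPair-onto union k with union k
  ... | inj₁ k∈X = vH k a₀ , from vH∈liftPair⇔ k∈X , block-vH
  ... | inj₂ k∈Y = vG k , from vG∈liftPair⇔ k∈Y , block-vG

  liftPair-spoke : ∀ {X Y i j b} → IsForwardEqualizedPair G X Y →
    vG i ∉ liftPair X Y → vH j b ∉ liftPair X Y → ∃[ k ] baseDist k (vG i) ≡ baseDist k (vH j b)
  liftPair-spoke {i = i} {j} (union , forward) vGi∉S vHj∉S =
    map₂ (from baseDist-vG-vH≡⇔) (forward i j i∈X i∉Y j∈Y j∉X)
    where
    i∉Y = vGi∉S ∘ from vG∈liftPair⇔
    j∉X = vHj∉S ∘ from vH∈liftPair⇔
    i∈X = [ id , ⊥-elim ∘ i∉Y ]′ (union i)
    j∈Y = [ ⊥-elim ∘ j∉X , id ]′ (union j)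

  liftPair-baseEqualized : ∀ {X Y} → IsVertexCoverBisector G X → IsVertexCoverBisector G Y →
    IsForwardEqualizedPair G X Y → BaseEqualized (liftPair X Y)
  liftPair-baseEqualized cX cY fe {x} {y} x∉S y∉S x≢y with position x | position y
  ... | gvertex i | gvertex j = map₂ (from baseDist-vG≡⇔)
    (equalizer-of-cover cY (x∉S ∘ from vG∈liftPair⇔) (y∉S ∘ from vG∈liftPair⇔) (x≢y ∘ cong vG))
  ... | gvertex i | hvertex j b = liftPair-spoke fe x∉S y∉S
  ... | hvertex i a | gvertex j = map₂ sym (liftPair-spoke fe y∉S x∉S)
  ... | hvertex i a | hvertex j b with i ≟ j
  ...   | yes refl = i , trans baseDist-vH (sym baseDist-vH)
  ...   | no i≢j = map₂ (from baseDist-vH≡⇔)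
    (equalizer-of-cover cX (x∉S ∘ from vH∈liftPair⇔) (y∉S ∘ from vH∈liftPair⇔) i≢j)

  liftPair-injectiveOn : ∀ {X Y} → Empty (X ∩ Y) → m ≡ 1 ⊎ Empty X → InjectiveOn block (liftPair X Y)
  liftPair-injectiveOn {X} {Y} disjoint thin {x} {y} x∈S y∈S bx≡by with position x | position y
  ... | gvertex i | gvertex j = cong vG (trans (sym block-vG) (trans bx≡by block-vG))
  ... | gvertex i | hvertex j b with trans (sym block-vG) (trans bx≡by block-vH)
  ...   | refl = ⊥-elim (disjoint (i , x∈p∩q⁺ (to vH∈liftPair⇔ y∈S , to vG∈liftPair⇔ x∈S)))
  liftPair-injectiveOn disjoint thin x∈S y∈S bx≡by | hvertex i a | gvertex j
    with trans (sym block-vH) (trans bx≡by block-vG)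
  ... | refl = ⊥-elim (disjoint (i , x∈p∩q⁺ (to vH∈liftPair⇔ x∈S , to vG∈liftPair⇔ y∈S)))
  liftPair-injectiveOn disjoint thin x∈S y∈S bx≡by | hvertex i a | hvertex j b
    with trans (sym block-vH) (trans bx≡by block-vH) | thin
  ... | refl | inj₁ m≡1 = cong (vH i) (Fin1-unique m≡1 a b)
  ... | refl | inj₂ X-empty = ⊥-elim (X-empty (i , to vH∈liftPair⇔ x∈S))

  ξ≡n-of-pair : ∀ {X Y} → IsVertexCoverBisector G X → IsVertexCoverBisector G Y →
    IsForwardEqualizedPair G X Y → Empty (X ∩ Y) → m ≡ 1 ⊎ Empty X → ξ≡ C n
  ξ≡n-of-pair cX cY fe disjoint thin = ξ≡n-intro
    (from (DE⇔BaseEqualized liftPair-copyClosed (liftPair-onto (proj₁ fe))) (liftPair-baseEqualized cX cY fe))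
    (injectiveOn⇒∣p∣≤k block (liftPair-injectiveOn disjoint thin))

  -- The pair (T , ⊤) lifts to the set of all vertices of G.
  ξ≡n-of-βBisector≡0 : βBisector≡ G 0 → ξ≡ C n
  ξ≡n-of-βBisector≡0 ((T , cT , ∣T∣≡0) , _) = ξ≡n-of-pair cT (λ _ _ _ → inj₁ ∈⊤)
    ((λ _ → inj₂ ∈⊤) , λ _ _ _ u∉⊤ → ⊥-elim (u∉⊤ ∈⊤))
    (λ (i , i∈T∩⊤) → T-empty (i , proj₁ (x∈p∩q⁻ T ⊤ i∈T∩⊤)))
    (inj₂ T-empty)
    where
    T-empty : Empty T
    T-empty = ∣p∣≡0⇒Empty ∣T∣≡0

  ξ≡n-of-β*≡0 : m ≡ 1 → β*≡ G 0 → ξ≡ C n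
  ξ≡n-of-β*≡0 m≡1 (((X , Y) , (cX , cY , fe) , ∣X∩Y∣≡0) , _) =
    ξ≡n-of-pair cX cY fe (∣p∣≡0⇒Empty ∣X∩Y∣≡0) (inj₁ m≡1)

  minimum-one-per-block : ∀ {S} → IsDistanceEqualizer C S → ∣ S ∣ ≡ n → InjectiveOn block S
  minimum-one-per-block de ∣S∣≡n = onto⇒injectiveOn block (DE⇒onto de) (ℕ.≤-reflexive ∣S∣≡n)

  βBisector≡0-of-ξ : ∀ {a b : Fin m} → a ≢ b → ξ≡ C n → βBisector≡ G 0
  βBisector≡0-of-ξ {a} {b} a≢b ((S , de , ∣S∣≡n) , _) =
    (⊥ , cover-of-equalized equalized , ∣⊥∣≡0 n) , λ _ _ → z≤n
    where
    free : ∀ i → ∃[ c ] vH i c ∉ S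
    free i with vH i a ∈? S | vH i b ∈? S
    ... | no vHa∉S | _ = a , vHa∉S
    ... | yes _ | no vHb∉S = b , vHb∉S
    ... | yes vHa∈S | yes vHb∈S = ⊥-elim (a≢b (proj₂ (vH-injective
      (minimum-one-per-block de ∣S∣≡n vHa∈S vHb∈S (trans block-vH (sym block-vH))))))

    equalized : ∀ {u v} → u ∉ ⊥ → v ∉ ⊥ → u ≢ v → ∃[ k ] EqDist G k u v
    equalized {u} {v} _ _ u≢v with free u | free v
    ... | c , vHc∉S | d , vHd∉S with de (vH u c) (vH v d) (u≢v ∘ proj₁ ∘ vH-injective) vHc∉S vHd∉S
    ...   | _ , _ , eq = equalizer-of-copies u≢v eq

  β*≡0-of-ξ : m ≡ 1 → ξ≡ C n → β*≡ G 0
  β*≡0-of-ξ m≡1 ((S , de , ∣S∣≡n) , _) =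
    ((X , Y) , (cover-of-equalized X-equalized , cover-of-equalized Y-equalized , union , forward) ,
      Empty⇒∣p∣≡0 disjoint) , λ _ _ → z≤n
    where
    X Y : Subset n
    X = preimage (λ i → vH i a₀) S
    Y = preimage vG S

    balanced : BaseEqualized S
    balanced = to (DE⇔BaseEqualized (λ {k} {a} {b} → subst (λ c → vH k c ∈ S) (Fin1-unique m≡1 a b))
                                    (DE⇒onto de)) de

    X-equalized : ∀ {u v} → u ∉ X → v ∉ X → u ≢ v → ∃[ k ] EqDist G k u v
    X-equalized u∉X v∉X u≢v = map₂ (to baseDist-vH≡⇔)
      (balanced (u∉X ∘ from ∈-preimage) (v∉X ∘ from ∈-preimage) (u≢v ∘ proj₁ ∘ vH-injective))

    Y-equalized : ∀ {u v} → u ∉ Y → v ∉ Y → u ≢ v → ∃[ k ] EqDist G k u v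
    Y-equalized u∉Y v∉Y u≢v = map₂ (to baseDist-vG≡⇔)
      (balanced (u∉Y ∘ from ∈-preimage) (v∉Y ∘ from ∈-preimage) (u≢v ∘ ↑ˡ-injective (n * m) _ _))

    union : ∀ i → i ∈ X ⊎ i ∈ Y
    union i with DE⇒onto de i
    ... | x , x∈S , bx≡i with position x
    ...   | gvertex j = inj₂ (from ∈-preimage (subst (λ t → vG t ∈ S) (trans (sym block-vG) bx≡i) x∈S))
    ...   | hvertex j c = inj₁ (from ∈-preimage
      (subst₂ (λ t d → vH t d ∈ S) (trans (sym block-vH) bx≡i) (Fin1-unique m≡1 c a₀) x∈S))

    forward : ∀ u v → u ∈ X → u ∉ Y → v ∈ Y → v ∉ X → ∃[ w ] ∃[ k ] (Dist G w u (suc k) × Dist G w v k)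
    forward u v _ u∉Y _ v∉X = map₂ (to baseDist-vG-vH≡⇔)
      (balanced (u∉Y ∘ from ∈-preimage) (v∉X ∘ from ∈-preimage) vG≢vH)

    disjoint : Empty (X ∩ Y)
    disjoint (i , i∈X∩Y) with x∈p∩q⁻ X Y i∈X∩Y
    ... | i∈X , i∈Y = vG≢vH (minimum-one-per-block de ∣S∣≡n
      (to ∈-preimage i∈Y) (to ∈-preimage i∈X) (trans block-vG (sym block-vH)))

theorem22 : (G H : Graph) → Connected G → 1 ≤ order H →
    (ξ≡ (G ⊙ H) (order G) ⇔ (βBisector≡ G 0 ⊎ (order H ≡ 1 × β*≡ G 0)))
theorem22 G H conn 1≤m = mk⇔ necessary [ ξ≡n-of-βBisector≡0 , uncurry ξ≡n-of-β*≡0 ]′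
  where
  open Corona G H conn 1≤m

  necessary : ξ≡ C n → βBisector≡ G 0 ⊎ (m ≡ 1 × β*≡ G 0)
  necessary ξ≡n with one-or-two 1≤m
  ... | inj₁ m≡1 = inj₂ (m≡1 , β*≡0-of-ξ m≡1 ξ≡n)
  ... | inj₂ (_ , _ , a≢b) = inj₁ (βBisector≡0-of-ξ a≢b ξ≡n)
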